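{- Let $k\ge1$, $d\ge1$, let $\mathcal{U}_1,\dots,\mathcal{U}_k\subseteq[d]$, let $\mathcal{S}_1,\dots,\mathcal{S}_{2^k-1}$ be an enumeration of the nonempty subsets of $[k]$, and let $\mathcal{D}_{\mathcal{S}}\subseteq[d]$ be given for each nonempty $\mathcal{S}\subseteq[k]$. Let $1\le\ell_1<\ell_2\le2^k-1$ and $i\in\mathcal{S}_{\ell_1}\cap\mathcal{S}_{\ell_2}$. Then \[ \mathcal{F}_i^{\ell_1,\ell_2}\subseteq\big(\mathcal{D}_{\mathcal{S}_{\ell_2}}\setminus\mathcal{U}_{\mathcal{S}_{\ell_2}}\big)\cup\Big(\bigcup_{i'\in\mathcal{S}_{\ell_2}}\ \bigcup_{\ell'\ge\ell_1:\ i'\in\mathcal{S}_{\ell'}}\big(\mathcal{U}_{\mathcal{S}_{\ell'}}\setminus\mathcal{D}_{\mathcal{S}_{\ell'}}\big)\Big). \]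
   Context: For $\mathcal{S}\subseteq[k]$, $\mathcal{U}_{\mathcal{S}}:=\bigcup_{i\in\mathcal{S}}\mathcal{U}_i$. For $i\in[k]$ and $\ell\in[2^k-1]$, $\mathcal{E}_i^\ell:=\bigcap_{\ell'\ge\ell,\ i\in\mathcal{S}_{\ell'}}\mathcal{D}_{\mathcal{S}_{\ell'}}$ (an empty intersection is $[d]$). For $\ell_1<\ell_2$ and $i\in\mathcal{S}_{\ell_1}\cap\mathcal{S}_{\ell_2}$, $\mathcal{F}_i^{\ell_1,\ell_2}:=\mathcal{E}_i^{\ell_1+1}\setminus\bigcup_{i'\in\mathcal{S}_{\ell_2}}\mathcal{E}_{i'}^{\ell_1}$. -}

module Defs where

open import Data.Nat using (ℕ; suc; _≤_)
open import Data.Fin using (Fin; toℕ)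
open import Data.Fin.Subset using (Subset; _∈_; _∉_; Nonempty)
open import Data.Product using (Σ; ∃; _×_)
open import Data.Sum using (_⊎_)
open import Relation.Nullary using (¬_)

-- Subsets of [d] and [k] are represented by Data.Fin.Subset (0-based indices).
-- An enumeration S_1..S_{2^k-1} is a map S : Fin n → Subset k (n = 2^k - 1),
-- with index ℓ (paper) corresponding to ℓ-1 here; order is preserved.

_∈U[_]_ : ∀ {k d} → Fin d → Subset k → (Fin k → Subset d) → Set
x ∈U[ T ] U = ∃ λ i → i ∈ T × x ∈ U i

-- x ∈ E_i^ℓ  :=  x ∈ ⋂_{ℓ' ≥ ℓ, i ∈ S_ℓ'} D_{S_ℓ'}  (ℓ a natural-number bound,
-- so that ℓ₁+1 is allowed; empty intersection is all of [d])
InE : ∀ {k d n} → (Fin n → Subset k) → (Subset k → Subset d)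
    → Fin k → ℕ → Fin d → Set
InE S D i ℓ x = ∀ (ℓ' : Fin _) → ℓ ≤ toℕ ℓ' → i ∈ S ℓ' → x ∈ D (S ℓ')

InF : ∀ {k d n} → (Fin n → Subset k) → (Subset k → Subset d)
    → Fin k → Fin n → Fin n → Fin d → Set
InF S D i ℓ₁ ℓ₂ x =
  InE S D i (suc (toℕ ℓ₁)) x × ¬ (∃ λ i' → i' ∈ S ℓ₂ × InE S D i' (toℕ ℓ₁) x)

InRHS : ∀ {k d n} → (Fin k → Subset d) → (Fin n → Subset k) → (Subset k → Subset d)
      → Fin n → Fin n → Fin d → Set
InRHS U S D ℓ₁ ℓ₂ x =
  (x ∈ D (S ℓ₂) × ¬ (x ∈U[ S ℓ₂ ] U))
  ⊎ (∃ λ i' → i' ∈ S ℓ₂ ×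
       (∃ λ ℓ' → toℕ ℓ₁ ≤ toℕ ℓ' × i' ∈ S ℓ' ×
                 (x ∈U[ S ℓ' ] U) × x ∉ D (S ℓ')))

module Submission where

-- Let x ∈ F_i^{ℓ₁,ℓ₂}, i.e. x ∈ E_i^{ℓ₁+1} and x ∉ E_{i'}^{ℓ₁}
-- for every i' ∈ S_ℓ₂.  Membership in U_{S_ℓ₂} is decidable, so split:
--   * x ∉ U_{S_ℓ₂}: since ℓ₂ ≥ ℓ₁+1 and i ∈ S_ℓ₂, the intersection defining
--     E_i^{ℓ₁+1} contains D_{S_ℓ₂}, so x ∈ D_{S_ℓ₂} \ U_{S_ℓ₂}.
--   * x ∈ U_j for some j ∈ S_ℓ₂: then x ∉ E_j^{ℓ₁}, and since E_j^{ℓ₁} is a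
--     finite intersection of decidable sets, some index ℓ' ≥ ℓ₁ with j ∈ S_ℓ'
--     has x ∉ D_{S_ℓ'}; as j ∈ S_ℓ' also x ∈ U_{S_ℓ'}, giving the second part.

open import Defs
open import Data.Nat using (ℕ; suc; _≤_; _^_; _∸_)
open import Data.Nat.Properties using (_≤?_)
open import Data.Fin using (Fin; _<_; toℕ)
open import Data.Fin.Properties using (any?; ¬∀⟶∃¬)
open import Data.Fin.Subset using (Subset; _∈_; _∉_; Nonempty)
open import Data.Fin.Subset.Properties using (_∈?_)
open import Data.Product using (∃; _×_; _,_)
open import Data.Sum using (inj₁; inj₂)
open import Relation.Binary.PropositionalEquality using (_≡_)
open import Relation.Nullary using (Dec; yes; no; ¬_; contradiction)
open import Relation.Nullary.Decidable using (_×-dec_; _→-dec_)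

refuted-implication : ∀ {a b c} {A : Set a} {B : Set b} {C : Set c}
  → Dec A → Dec B → ¬ (A → B → C) → A × B × ¬ C
refuted-implication (no ¬a)  _        ¬f = contradiction (λ a → contradiction a ¬a) ¬f
refuted-implication (yes a)  (no ¬b)  ¬f = contradiction (λ _ b → contradiction b ¬b) ¬f
refuted-implication (yes a)  (yes b)  ¬f = a , b , λ c → ¬f (λ _ _ → c)

escape-from-E : ∀ {k d n} (S : Fin n → Subset k) (D : Subset k → Subset d)
  (j : Fin k) (ℓ : ℕ) (x : Fin d) → ¬ InE S D j ℓ x
  → ∃ λ ℓ' → ℓ ≤ toℕ ℓ' × j ∈ S ℓ' × x ∉ D (S ℓ')
escape-from-E {n = n} S D j ℓ x x∉E =
  let ℓ' , ¬member = ¬∀⟶∃¬ n _ member? x∉E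
  in  ℓ' , refuted-implication (ℓ ≤? toℕ ℓ') (j ∈? S ℓ') ¬member
  where
  member? : ∀ ℓ' → Dec (ℓ ≤ toℕ ℓ' → j ∈ S ℓ' → x ∈ D (S ℓ'))
  member? ℓ' = (ℓ ≤? toℕ ℓ') →-dec ((j ∈? S ℓ') →-dec (x ∈? D (S ℓ')))

_∈U?[_]_ : ∀ {k d} (x : Fin d) (T : Subset k) (U : Fin k → Subset d)
  → Dec (x ∈U[ T ] U)
x ∈U?[ T ] U = any? (λ j → (j ∈? T) ×-dec (x ∈? U j))

uncovered-case : ∀ {k d n} (U : Fin k → Subset d) (S : Fin n → Subset k)
  (D : Subset k → Subset d) (ℓ₁ ℓ₂ : Fin n) → ℓ₁ < ℓ₂
  → (i : Fin k) → i ∈ S ℓ₂ → (x : Fin d)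
  → InE S D i (suc (toℕ ℓ₁)) x → ¬ (x ∈U[ S ℓ₂ ] U) → InRHS U S D ℓ₁ ℓ₂ x
uncovered-case U S D ℓ₁ ℓ₂ ℓ₁<ℓ₂ i i∈S₂ x x∈E x∉U = inj₁ (x∈E ℓ₂ ℓ₁<ℓ₂ i∈S₂ , x∉U)

covered-case : ∀ {k d n} (U : Fin k → Subset d) (S : Fin n → Subset k)
  (D : Subset k → Subset d) (ℓ₁ ℓ₂ : Fin n) (x : Fin d)
  → ¬ (∃ λ i' → i' ∈ S ℓ₂ × InE S D i' (toℕ ℓ₁) x)
  → x ∈U[ S ℓ₂ ] U → InRHS U S D ℓ₁ ℓ₂ x
covered-case U S D ℓ₁ ℓ₂ x x∉⋃E (j , j∈S₂ , x∈Uj)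
  with ℓ' , ℓ₁≤ℓ' , j∈S' , x∉D ← escape-from-E S D j (toℕ ℓ₁) x (λ x∈E → x∉⋃E (j , j∈S₂ , x∈E))
  = inj₂ (j , j∈S₂ , ℓ' , ℓ₁≤ℓ' , j∈S' , (j , j∈S' , x∈Uj) , x∉D)

lemma8 : (k d : ℕ) → 1 ≤ k → 1 ≤ d
    → (U : Fin k → Subset d)
    → (S : Fin (2 ^ k ∸ 1) → Subset k)
    → (∀ ℓ → Nonempty (S ℓ))
    → (∀ ℓ ℓ' → S ℓ ≡ S ℓ' → ℓ ≡ ℓ')
    → (∀ (T : Subset k) → Nonempty T → ∃ λ ℓ → S ℓ ≡ T)
    → (D : Subset k → Subset d)
    → (ℓ₁ ℓ₂ : Fin (2 ^ k ∸ 1)) → ℓ₁ < ℓ₂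
    → (i : Fin k) → i ∈ S ℓ₁ → i ∈ S ℓ₂
    → (x : Fin d) → InF S D i ℓ₁ ℓ₂ x → InRHS U S D ℓ₁ ℓ₂ x
lemma8 k d _ _ U S _ _ _ D ℓ₁ ℓ₂ ℓ₁<ℓ₂ i _ i∈S₂ x (x∈E , x∉⋃E)
  with x ∈U?[ S ℓ₂ ] U
... | no  x∉U = uncovered-case U S D ℓ₁ ℓ₂ ℓ₁<ℓ₂ i i∈S₂ x x∈E x∉U
... | yes x∈U = covered-case U S D ℓ₁ ℓ₂ x x∉⋃E x∈U
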